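{- Let $\Gamma$ be a $k$-tight $2$--Cayley digraph of order $N$, where $N$ is not square-free, and suppose $N=N'm^2$ with integers $N'\ge1$, $m\geq1$. If there is a minimum distance diagram $\mathcal{H}=\mathrm{L}(l,h,w,y)$ of area $N'$ with $\mathrm{d}_{\mathcal{H}}<\frac{\mathrm{lb}(N)+k+2}{m}-2$, then any $2$--Cayley digraph $\Delta$ having the $m$-extension $m\mathcal{H}=\mathrm{L}(ml,mh,mw,my)$ as a minimum distance diagram satisfies $\mathrm{D}(\Delta)<\mathrm{D}(\Gamma)$.
   Context: A $2$--Cayley digraph is $\mathrm{Cay}(\mathrm{G},\{a,b\})$ with $\mathrm{G}$ a finite Abelian group, $a,b\in\mathrm{G}\setminus\{0\}$ generating it; vertices $\mathrm{G}$, arcs $g\to g+a$, $g\to g+b$; $\mathrm{D}(\cdot)$ is its diameter. $\mathrm{lb}(N)=\lceil\sqrt{3N}\rceil-2$; a $2$--Cayley digraph of order $N$ is $k$-tight if its diameter equals $\mathrm{lb}(N)+k$. A minimum distance diagram of $\mathrm{Cay}(\mathrm{G},\{a,b\})$ is a map $\psi:\mathrm{G}\to\mathbb{N}^2$ with $\psi(\eta)=(i,j)$, $ia+jb=\eta$, $i+j$ minimal, image closed under coordinatewise smaller vectors in $\mathbb{N}^2$. For integers $0\le w<l$, $0\le y<h$, the L-shape $\mathrm{L}(l,h,w,y)=\{(i,j)\in\mathbb{Z}^2:0\le i<l,0\le j<h\}\setminus\{(i,j):l-w\le i<l,h-y\le j<h\}$ has area $lh-wy$ and diameter $\mathrm{d}_{\mathrm{L}(l,h,w,y)}=l+h-\min\{w,y\}-2$;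 it is a minimum distance diagram (of a digraph) if it is the image of such a $\psi$, in which case its diameter equals the digraph's diameter. -}

module Defs where

open import Level using (0ℓ)
open import Algebra.Bundles using (AbelianGroup)
open import Data.Nat as ℕ using (ℕ; zero; suc; _+_; _*_; _∸_; _≤_; _<_; _≤ᵇ_; _⊓_)
open import Data.Integer as ℤ using (ℤ; +_; -[1+_])
open import Data.Fin using (Fin)
open import Data.Bool using (if_then_else_)
open import Data.Product using (Σ; ∃; ∃-syntax; _×_; _,_; proj₁; proj₂)
open import Data.Nat.Divisibility using (_∣_)
open import Relation.Nullary using (¬_)
open import Relation.Binary.PropositionalEquality using (_≡_)

-- Ceiling of the square root: least s with n ≤ s * s (bounded search; s = n always works).
ceilSqrt : ℕ → ℕ
ceilSqrt n = go n 0
  where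
  go : ℕ → ℕ → ℕ
  go zero    s = s
  go (suc f) s = if n ≤ᵇ s * s then s else go f (suc s)

lb : ℕ → ℤ
lb N = + ceilSqrt (3 * N) ℤ.- + 2

SquareFree : ℕ → Set
SquareFree N = ∀ d → d * d ∣ N → d ≡ 1

module _ (G : AbelianGroup 0ℓ 0ℓ) where
  open AbelianGroup G
  mul : ℕ → Carrier → Carrier
  mul zero    x = ε
  mul (suc n) x = x ∙ mul n x

  zmul : ℤ → Carrier → Carrier
  zmul (+ n)     x = mul n x
  zmul -[1+ n ]  x = (mul (suc n) x) ⁻¹

record Cay2 (N : ℕ) : Set₁ where
  field
    G : AbelianGroup 0ℓ 0ℓ
  open AbelianGroup G public
  field
    a b   : Carrier
    a≉ε   : ¬ (a ≈ ε)
    b≉ε   : ¬ (b ≈ ε)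
    enum  : Fin N → Carrier
    enum-inj  : ∀ i j → enum i ≈ enum j → i ≡ j
    enum-surj : ∀ g → ∃[ i ] (enum i ≈ g)

  field
    generates : ∀ g → ∃[ i ] ∃[ j ] (zmul G i a ∙ zmul G j b ≈ g)


module _ {N : ℕ} (Γ : Cay2 N) where
  open Cay2 Γ
  data Walk : Carrier → Carrier → ℕ → Set where
    here  : ∀ {x y} → x ≈ y → Walk x y 0
    stepA : ∀ {x y n} → Walk (x ∙ a) y n → Walk x y (suc n)
    stepB : ∀ {x y n} → Walk (x ∙ b) y n → Walk x y (suc n)

HasDiameter : ∀ {N} → Cay2 N → ℕ → Set
HasDiameter Γ d =
  (∀ x y → ∃[ n ] (n ≤ d × Walk Γ x y n)) ×
  (∃[ x ] ∃[ y ] (∀ n → Walk Γ x y n → d ≤ n))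
  where open Cay2 Γ

Tight : ∀ {N} → Cay2 N → ℤ → Set
Tight {N} Γ k = ∃[ d ] (HasDiameter Γ d × (+ d ≡ lb N ℤ.+ k))

IsMDD : ∀ {N} (Γ : Cay2 N) → (Cay2.Carrier Γ → ℕ × ℕ) → Set
IsMDD Γ ψ =
  (∀ x y → x ≈ y → ψ x ≡ ψ y) ×
  (∀ η → mul G (proj₁ (ψ η)) a ∙ mul G (proj₂ (ψ η)) b ≈ η) ×
  (∀ η i j → mul G i a ∙ mul G j b ≈ η → proj₁ (ψ η) + proj₂ (ψ η) ≤ i + j) ×
  (∀ η i j → i ≤ proj₁ (ψ η) → j ≤ proj₂ (ψ η) → ∃[ η' ] (ψ η' ≡ (i , j)))
  where open Cay2 Γ

InL : ℕ → ℕ → ℕ → ℕ → ℕ × ℕ → Set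
InL l h w y (i , j) = i < l × j < h × ¬ ((l ∸ w ≤ i × i < l) × (h ∸ y ≤ j × j < h))

IsMDDL : ∀ {N} → Cay2 N → ℕ → ℕ → ℕ → ℕ → Set
IsMDDL Γ l h w y =
  Σ (Cay2.Carrier Γ → ℕ × ℕ) λ ψ →
    IsMDD Γ ψ × (∀ η → InL l h w y (ψ η)) × (∀ p → InL l h w y p → ∃[ η ] (ψ η ≡ p))

areaL : ℕ → ℕ → ℕ → ℕ → ℕ
areaL l h w y = l * h ∸ w * y

diamL : ℕ → ℕ → ℕ → ℕ → ℕ
diamL l h w y = l + h ∸ (w ⊓ y) ∸ 2

-- Every vertex x reaches y along the word a^i b^j, where ψ(-x + y) = (i , j), so the diameter
-- of a digraph is at most the largest i + j on its minimum distance diagram, which on an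
-- L-shape L(l,h,w,y) is l + h - min{w,y} - 2. This quantity scales by m under the
-- m-extension (up to the -2), so D(Δ) + 2 ≤ m (d_H + 2), and the hypothesis on d_H says
-- exactly that m (d_H + 2) < lb(N) + k + 2 = D(Γ) + 2.
module Submission where

open import Defs
open import Data.Nat as ℕ using (ℕ; _*_; _<_; _≤_; NonZero; zero; suc; _+_; _∸_; _⊓_)
open import Data.Nat.Properties as ℕP
  using (≤-trans; <⇒≤; ≰⇒>; n≮0; +-monoˡ-≤; +-monoʳ-≤; +-mono-≤; *-monoʳ-≤; +-cancelʳ-<;
         m⊓n≤m; m⊓n≤n; m+n≤o⇒m≤o∸n; m≤o∸n⇒m+n≤o; m≤n+m∸n; m∸n≢0⇒n<m; module ≤-Reasoning)
open import Data.Nat.Solver using (module +-*-Solver)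
open import Data.Integer as ℤ using (ℤ; +_)
import Data.Integer.Properties as ℤP
open import Data.Rational.Unnormalised as ℚ using (_/_)
import Data.Rational.Unnormalised.Properties as ℚP
open import Data.Product using (Σ; _×_; _,_; proj₁; proj₂; ∃-syntax)
open import Relation.Nullary using (¬_; Dec; yes; no)
open import Relation.Binary.PropositionalEquality as ≡ using (_≡_; subst)

module _ {N : ℕ} (Γ : Cay2 N) where
  open Cay2 Γ renaming (sym to ≈-sym; trans to ≈-trans)

  Walk-resp-≈ : ∀ {x x' y n} → x ≈ x' → Walk Γ x y n → Walk Γ x' y n
  Walk-resp-≈ x≈x' (here x≈y) = here (≈-trans (≈-sym x≈x') x≈y)
  Walk-resp-≈ x≈x' (stepA w)  = stepA (Walk-resp-≈ (∙-congʳ x≈x') w)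
  Walk-resp-≈ x≈x' (stepB w)  = stepB (Walk-resp-≈ (∙-congʳ x≈x') w)

  walk-a^i : ∀ i {x y n} → Walk Γ (x ∙ mul G i a) y n → Walk Γ x y (i + n)
  walk-a^i zero    w = Walk-resp-≈ (identityʳ _) w
  walk-a^i (suc i) w = stepA (walk-a^i i (Walk-resp-≈ (≈-sym (assoc _ a (mul G i a))) w))

  walk-b^j : ∀ j {x y} → x ∙ mul G j b ≈ y → Walk Γ x y j
  walk-b^j zero    x∙ε≈y = here (≈-trans (≈-sym (identityʳ _)) x∙ε≈y)
  walk-b^j (suc j) x∙b^j≈y = stepB (walk-b^j j (≈-trans (assoc _ b (mul G j b)) x∙b^j≈y))

  walk-a^i·b^j : ∀ i j {x y} → mul G i a ∙ mul G j b ≈ x ⁻¹ ∙ y → Walk Γ x y (i + j)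
  walk-a^i·b^j i j {x} {y} a^i·b^j≈x⁻¹y = walk-a^i i (walk-b^j j (begin
    (x ∙ mul G i a) ∙ mul G j b ≈⟨ assoc x _ _ ⟩
    x ∙ (mul G i a ∙ mul G j b) ≈⟨ ∙-congˡ a^i·b^j≈x⁻¹y ⟩
    x ∙ (x ⁻¹ ∙ y)              ≈⟨ ≈-sym (assoc x (x ⁻¹) y) ⟩
    (x ∙ x ⁻¹) ∙ y              ≈⟨ ∙-congʳ (inverseʳ x) ⟩
    ε ∙ y                       ≈⟨ identityˡ y ⟩
    y                           ∎))
    where open import Relation.Binary.Reasoning.Setoid setoid

HasDiameter⇒≤ : ∀ {N} {Γ : Cay2 N} {d e} → HasDiameter Γ d →
                (∀ x y → ∃[ n ] (n ≤ e × Walk Γ x y n)) → d ≤ e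
HasDiameter⇒≤ (_ , x , y , far) reach with reach x y
... | n , n≤e , w = ≤-trans (far n w) n≤e

m<o∸n⇒m+n<o : ∀ {m n o} → m < o ∸ n → m + n < o
m<o∸n⇒m+n<o {m} {n} {o} m<o∸n = m≤o∸n⇒m+n≤o (suc m) n≤o m<o∸n
  where
  n≤o : n ≤ o
  n≤o = <⇒≤ (m∸n≢0⇒n<m λ o∸n≡0 → n≮0 (subst (m <_) o∸n≡0 m<o∸n))

InL⇒i+j+2≤l+h∸w⊓y : ∀ {l h w y i j} → InL l h w y (i , j) → i + j + 2 ≤ l + h ∸ w ⊓ y
InL⇒i+j+2≤l+h∸w⊓y {l} {h} {w} {y} {i} {j} (i<l , j<h , ¬corner) =
  m+n≤o⇒m≤o∸n (i + j + 2) (outside-corner (l ∸ w ℕ.≤? i) (h ∸ y ℕ.≤? j))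
  where
  open ≤-Reasoning
  open +-*-Solver

  outside-corner : Dec (l ∸ w ≤ i) → Dec (h ∸ y ≤ j) → i + j + 2 + w ⊓ y ≤ l + h
  outside-corner (yes l∸w≤i) (yes h∸y≤j) with () ← ¬corner ((l∸w≤i , i<l) , (h∸y≤j , j<h))
  outside-corner (no l∸w≰i) _ = begin
    i + j + 2 + w ⊓ y       ≡⟨ solve 3 (λ i j m → i :+ j :+ con 2 :+ m := (con 1 :+ i :+ m) :+ (con 1 :+ j))
                                       ≡.refl i j (w ⊓ y) ⟩
    (suc i + w ⊓ y) + suc j ≤⟨ +-mono-≤ (≤-trans (+-monoʳ-≤ (suc i) (m⊓n≤m w y)) (m<o∸n⇒m+n<o (≰⇒> l∸w≰i))) j<h ⟩
    l + h ∎
  outside-corner (yes _) (no h∸y≰j) = begin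
    i + j + 2 + w ⊓ y       ≡⟨ solve 3 (λ i j m → i :+ j :+ con 2 :+ m := (con 1 :+ i) :+ (con 1 :+ j :+ m))
                                       ≡.refl i j (w ⊓ y) ⟩
    suc i + (suc j + w ⊓ y) ≤⟨ +-mono-≤ i<l (≤-trans (+-monoʳ-≤ (suc j) (m⊓n≤n w y)) (m<o∸n⇒m+n<o (≰⇒> h∸y≰j))) ⟩
    l + h ∎

-- Since diamL truncates at 0, the bound D ≤ d_L is kept in the form D + 2 ≤ l + h - min{w,y}.
IsMDDL⇒diameter+2≤l+h∸w⊓y : ∀ {N} {Γ : Cay2 N} {l h w y d} → IsMDDL Γ l h w y →
                             HasDiameter Γ d → d + 2 ≤ l + h ∸ w ⊓ y
IsMDDL⇒diameter+2≤l+h∸w⊓y {Γ = Γ} {w = w} {y}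
  (ψ , (_ , ψ-represents , _ , _) , ψ∈L , _) (_ , x , x' , far) =
  ≤-trans (+-monoˡ-≤ 2 (far _ (walk-a^i·b^j Γ (proj₁ (ψ η)) (proj₂ (ψ η)) (ψ-represents η))))
          (InL⇒i+j+2≤l+h∸w⊓y {w = w} {y} (ψ∈L η))
  where
  open Cay2 Γ using (_⁻¹; _∙_)
  η = x ⁻¹ ∙ x'

*-distribˡ-l+h∸w⊓y : ∀ m l h w y → m * l + m * h ∸ (m * w) ⊓ (m * y) ≡ m * (l + h ∸ w ⊓ y)
*-distribˡ-l+h∸w⊓y m l h w y = begin
  m * l + m * h ∸ (m * w) ⊓ (m * y) ≡⟨ ≡.cong₂ _∸_ (≡.sym (ℕP.*-distribˡ-+ m l h)) (≡.sym (ℕP.*-distribˡ-⊓ m w y)) ⟩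
  m * (l + h) ∸ m * (w ⊓ y)         ≡⟨ ≡.sym (ℕP.*-distribˡ-∸ m (l + h) (w ⊓ y)) ⟩
  m * (l + h ∸ w ⊓ y)               ∎
  where open ≡.≡-Reasoning

e<n/m-2⇒m*[e+2]<n : ∀ e n m .{{_ : NonZero m}} →
                     (+ e / 1) ℚ.< ((+ n / m) ℚ.- (+ 2 / 1)) → m * (e + 2) < n
e<n/m-2⇒m*[e+2]<n e n m@(suc _) e<n/m-2 =
  ℤP.drop‿+<+ (≡.subst₂ ℤ._<_ lhs (ℤP.*-identityʳ (+ n)) (ℚP.drop-*<* e+2<q))
  where
  q = + n / m
  q-2+2≃q : (q ℚ.- + 2 / 1) ℚ.+ + 2 / 1 ℚ.≃ q
  q-2+2≃q = ℚP.≃-trans (ℚP.+-assoc q (ℚ.- (+ 2 / 1)) (+ 2 / 1))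
              (ℚP.≃-trans (ℚP.+-congʳ q (ℚP.+-inverseˡ (+ 2 / 1))) (ℚP.+-identityʳ q))
  e+2<q : (+ e / 1) ℚ.+ (+ 2 / 1) ℚ.< q
  e+2<q = ℚP.<-respʳ-≃ q-2+2≃q (ℚP.+-monoˡ-< (+ 2 / 1) e<n/m-2)
  lhs : (+ e ℤ.* + 1 ℤ.+ + 2 ℤ.* + 1) ℤ.* + m ≡ + (m * (e + 2))
  lhs = begin
    (+ e ℤ.* + 1 ℤ.+ + 2) ℤ.* + m ≡⟨ ≡.cong (λ z → (z ℤ.+ + 2) ℤ.* + m) (ℤP.*-identityʳ (+ e)) ⟩
    + (e + 2) ℤ.* + m             ≡⟨ ℤP.*-comm (+ (e + 2)) (+ m) ⟩
    + m ℤ.* + (e + 2)             ≡⟨ ≡.sym (ℤP.pos-* m (e + 2)) ⟩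
    + (m * (e + 2))               ∎
    where open ≡.≡-Reasoning

corollary2 : (N : ℕ) (Γ : Cay2 N) (k : ℤ) → Tight Γ k → ¬ SquareFree N →
    (N' m : ℕ) → .{{_ : NonZero m}} → 1 ℕ.≤ N' → N ≡ N' * (m * m) →
    (l h w y : ℕ) → w < l → y < h →
    Σ ℕ (λ N₀ → Σ (Cay2 N₀) (λ Γ' → IsMDDL Γ' l h w y)) →
    areaL l h w y ≡ N' →
    (+ diamL l h w y / 1) ℚ.< (((lb N ℤ.+ k ℤ.+ + 2) / m) ℚ.- (+ 2 / 1)) →
    (M : ℕ) (Δ : Cay2 M) → IsMDDL Δ (m * l) (m * h) (m * w) (m * y) →
    (dΔ dΓ : ℕ) → HasDiameter Δ dΔ → HasDiameter Γ dΓ → dΔ < dΓ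
-- Only tightness, the bound on d_H and the diagram of Δ matter.
corollary2 N Γ k (d , d-diam , d≡lb+k) _ N' m _ _ l h w y _ _ _ _ dH<lb+k+2/m-2
  M Δ mΔ-mdd dΔ dΓ dΔ-diam dΓ-diam =
  ≤-trans (+-cancelʳ-< 2 dΔ d dΔ+2<d+2) (HasDiameter⇒≤ d-diam (proj₁ dΓ-diam))
  where
  lb+k+2≡d+2 : lb N ℤ.+ k ℤ.+ + 2 ≡ + (d + 2)
  lb+k+2≡d+2 = ≡.trans (≡.cong (ℤ._+ + 2) (≡.sym d≡lb+k)) (≡.sym (ℤP.pos-+ d 2))
  dH<[d+2]/m-2 : + diamL l h w y / 1 ℚ.< (+ (d + 2) / m) ℚ.- + 2 / 1
  dH<[d+2]/m-2 = subst (λ X → + diamL l h w y / 1 ℚ.< (X / m) ℚ.- + 2 / 1) lb+k+2≡d+2 dH<lb+k+2/m-2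
  open ≤-Reasoning
  dΔ+2<d+2 : dΔ + 2 < d + 2
  dΔ+2<d+2 = begin-strict
    dΔ + 2                             ≤⟨ IsMDDL⇒diameter+2≤l+h∸w⊓y {w = m * w} {y = m * y} mΔ-mdd dΔ-diam ⟩
    m * l + m * h ∸ (m * w) ⊓ (m * y)  ≡⟨ *-distribˡ-l+h∸w⊓y m l h w y ⟩
    m * (l + h ∸ w ⊓ y)                ≤⟨ *-monoʳ-≤ m (m≤n+m∸n _ 2) ⟩
    m * (2 + diamL l h w y)            ≡⟨ ≡.cong (m *_) (ℕP.+-comm 2 _) ⟩
    m * (diamL l h w y + 2)            <⟨ e<n/m-2⇒m*[e+2]<n _ (d + 2) m dH<[d+2]/m-2 ⟩
    d + 2                              ∎
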